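{- Let an rSSTP instance be given: an undirected graph $G=(V,E)$ with bidirected arc set $A$, a root $r\in V$, and scenarios $k\in\mathcal K=\{1,\dots,K\}$ with terminal sets $T^k\ni r$; let $V_r=V\setminus\{r\}$, $T^k_r=T^k\setminus\{r\}$, $t^*_r=\sum_k|T^k_r|$, $\delta^-(S)=\{(i,j)\in A:i\notin S,j\in S\}$, $\delta^-(v)=\delta^-(\{v\})$. Let $P_{dc2}$ be the set of $(z^0,y^{1\dots K})\in[0,1]^{|A|(K+1)}$ with $z^0(\delta^-(S))\ge z^0(\delta^-(v))$ for all $\emptyset\ne S\subseteq V_r$, $v\in S$; $y^k(\delta^-(S))\ge1$ for all $k$ and $S\subseteq V_r$ with $S\cap T^k_r\ne\emptyset$; $y^k_{ij}\ge z^0_{ij}$ for all $k$, $(i,j)\in A$; and $z^0(\delta^-(v))\le1$ for all $v\in V_r$. Let $P_{df}$ be the set of $(z^0,y^{1\dots K},w^0,f)\in[0,1]^{|A|(K+1)}\times[0,1]^{V_r}\times[0,1]^{|A|(|V_r|+t^*_r)}$ (flow variables $f^{0,v}_{ij}$ for $v\in V_r$ and $f^{k,t}_{ij}$ for $k\in\mathcal K$, $t\in T^k_r$, $(i,j)\in A$) satisfying: $z^0_{ij}\ge f^{0,v}_{ij}$ for all $v\in V_r$, $(i,j)\in A$; $w^0_v\ge z^0(\delta^-(v))$ for all $v\in V_r$; $\sum_{(h,i)\in A}f^{0,v}_{hi}-\sum_{(i,j)\in A}f^{0,v}_{ij}$ equals $-w^0_v$ if $i=r$, $w^0_v$ if $i=v$,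 and $0$ otherwise, for all $v\in V_r$, $i\in V$; $y^k_{ij}\ge z^0_{ij}$ for all $k$, $(i,j)\in A$; $y^k_{ij}\ge f^{k,t}_{ij}$ for all $k$, $(i,j)\in A$, $t\in T^k_r$; and $\sum_{(h,i)\in A}f^{k,t}_{hi}-\sum_{(i,j)\in A}f^{k,t}_{ij}$ equals $-1$ if $i=r$, $1$ if $i=t$, and $0$ otherwise, for all $k$, $t\in T^k_r$, $i\in V$. Then $P_{dc2}=\{(z^0,y^{1\dots K}):\exists(w^0,f),\ (z^0,y^{1\dots K},w^0,f)\in P_{df}\}$.
   Context: For a vector $z$ indexed by arcs and $A'\subseteq A$, $z(A')=\sum_{a\in A'}z_a$. In the flow conservation equalities, inflow minus outflow at $i$ is written on the left, so the flows are sent from the root $r$ to $v$ (first stage) and to $t$ (scenario $k$).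
   Formalization: All coordinates of the points $(z^0,y^{1\dots K})$ and of the witnesses $(w^0,f)$ are rational. -}

module Defs where

open import Data.Nat using (ℕ; zero; suc)
open import Data.Bool using (Bool; true; false; if_then_else_; _∧_; not)
open import Data.Fin using (Fin; _≟_)
import Data.Fin as F
open import Data.Vec using (lookup)
open import Data.Fin.Subset using (Subset; _∈_; _∉_; ⁅_⁆)
open import Data.Rational using (ℚ; 0ℚ; 1ℚ; _+_; _-_; -_; _≤_)
open import Data.Product using (_×_; ∃; ∃-syntax; Σ)
open import Relation.Binary.PropositionalEquality using (_≡_; _≢_)
open import Relation.Nullary.Decidable using (⌊_⌋)

sumFin : ∀ {n} → (Fin n → ℚ) → ℚ
sumFin {zero}  f = 0ℚ
sumFin {suc n} f = f F.zero + sumFin (λ i → f (F.suc i))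

-- an undirected simple graph on vertex set Fin n, given by a symmetric
-- irreflexive adjacency relation; its bidirected arc set A consists of the
-- ordered pairs (i , j) with adj i j ≡ true.
record Graph (n : ℕ) : Set where
  field
    adj    : Fin n → Fin n → Bool
    sym    : ∀ i j → adj i j ≡ adj j i
    irrefl : ∀ i → adj i i ≡ false

record Instance : Set where
  field
    n      : ℕ
    K      : ℕ
    G      : Graph n
    r      : Fin n
    T      : Fin K → Subset n
    r∈T    : ∀ k → r ∈ T k
  open Graph G public

module _ (I : Instance) where
  open Instance I

  Arc : Fin n → Fin n → Set
  Arc i j = adj i j ≡ true

  -- arc vectors are functions on ordered pairs; only arc entries matter
  ArcVec : Set
  ArcVec = Fin n → Fin n → ℚ

  In01 : ℚ → Set
  In01 q = (0ℚ ≤ q) × (q ≤ 1ℚ)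

  cutIn : Subset n → ArcVec → ℚ
  cutIn S x = sumFin λ i → sumFin λ j →
    if adj i j ∧ not (lookup S i) ∧ lookup S j then x i j else 0ℚ

  inflow : ArcVec → Fin n → ℚ
  inflow x i = sumFin λ h → if adj h i then x h i else 0ℚ

  outflow : ArcVec → Fin n → ℚ
  outflow x i = sumFin λ j → if adj i j then x i j else 0ℚ

  demand : Fin n → ℚ → Fin n → ℚ
  demand s a i = if ⌊ i ≟ r ⌋ then - a else (if ⌊ i ≟ s ⌋ then a else 0ℚ)

  Pdc2 : ArcVec → (Fin K → ArcVec) → Set
  Pdc2 z y =
      (∀ i j → Arc i j → In01 (z i j))
    × (∀ k i j → Arc i j → In01 (y k i j))
    × (∀ (S : Subset n) → r ∉ S → ∀ v → v ∈ S → cutIn ⁅ v ⁆ z ≤ cutIn S z)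
    × (∀ k (S : Subset n) → r ∉ S → (∃[ t ] (t ∈ S × t ∈ T k)) → 1ℚ ≤ cutIn S (y k))
    × (∀ k i j → Arc i j → z i j ≤ y k i j)
    × (∀ v → v ≢ r → cutIn ⁅ v ⁆ z ≤ 1ℚ)

  -- P_df ; w v is w⁰_v, f0 v is f^{0,v}, fk k t is f^{k,t}
  Pdf : ArcVec → (Fin K → ArcVec) → (Fin n → ℚ) → (Fin n → ArcVec)
      → (Fin K → Fin n → ArcVec) → Set
  Pdf z y w f0 fk =
      (∀ i j → Arc i j → In01 (z i j))
    × (∀ k i j → Arc i j → In01 (y k i j))
    × (∀ v → v ≢ r → In01 (w v))
    × (∀ v → v ≢ r → ∀ i j → Arc i j → In01 (f0 v i j))
    × (∀ k t → t ∈ T k → t ≢ r → ∀ i j → Arc i j → In01 (fk k t i j))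
    × (∀ v → v ≢ r → ∀ i j → Arc i j → f0 v i j ≤ z i j)
    × (∀ v → v ≢ r → cutIn ⁅ v ⁆ z ≤ w v)
    × (∀ v → v ≢ r → ∀ i → inflow (f0 v) i - outflow (f0 v) i ≡ demand v (w v) i)
    × (∀ k i j → Arc i j → z i j ≤ y k i j)
    × (∀ k i j → Arc i j → ∀ t → t ∈ T k → t ≢ r → fk k t i j ≤ y k i j)
    × (∀ k t → t ∈ T k → t ≢ r → ∀ i →
         inflow (fk k t) i - outflow (fk k t) i ≡ demand t 1ℚ i)

-- Flows give cuts by weak duality: summing flow conservation over a set S with r ∉ S ∋ t
-- shows that the value of an r–t flow is its net flow into S, which is at most the capacity
-- of δ⁻(S).  Conversely, the cut inequalities of P_dc2 are max-flow min-cut conditions for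
-- the values z⁰(δ⁻(v)) and 1.  All data are rational, so capacities and values are natural
-- multiples of a unit u = 1/D, D a common denominator.  Ford–Fulkerson augments by u along
-- flows found by exploring the residual network; when the exploration stops without
-- reaching t, the arcs leaving the explored set R have residual capacity below u, hence 0,
-- so the cut δ⁻(V ∖ R) carries exactly the current flow value and the cut inequality
-- rules this out.

module Submission where

open import Defs
open import Data.Fin using (Fin)
open import Data.Rational using (ℚ)
open import Data.Product using (∃-syntax)
open import Function.Bundles using (_⇔_)

open import Algebra.Bundles using (CommutativeRing)
open import Data.Bool using (Bool; true; false; if_then_else_; _∧_; not)
import Data.Bool as Bool
open import Data.Bool.Properties using (¬-not; ∧-comm; ∧-zeroʳ; if-eta)
open import Data.Empty using (⊥-elim)
import Data.Fin as F
open import Data.Fin using (_≟_)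
open import Data.Fin.Properties using (any?)
open import Data.Fin.Subset using (Subset; _∈_; _∉_; _⊆_; _⊃_; _∪_; ⁅_⁆; ∁)
open import Data.Fin.Subset.Induction using (⊃-wellFounded)
open import Data.Fin.Subset.Properties
  using (_∈?_; x∈p⇒x∉∁p; x∉p⇒x∈∁p; x∉∁p⇒x∈p; x∈∁p⇒x∉p; x∈p∪q⁺; x∈p∪q⁻; p⊆p∪q; x∈⁅x⁆; x∈⁅y⁆⇒x≡y)
import Data.Integer as ℤ
import Data.Integer.Properties as ℤ
open import Data.Nat using (ℕ; zero; suc)
import Data.Nat as ℕ
open import Data.Nat.Divisibility using (_∣_; divides; m∣m*n; ∣n⇒∣m*n; ∣-trans)
open import Data.Nat.Properties using (m*n≢0)
open import Data.Product using (Σ; _,_; proj₁; proj₂; _×_)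
open import Data.Rational
  using (mkℚ; ↥_; ↧ₙ_; toℚᵘ; 0ℚ; 1ℚ; _+_; _-_; -_; _*_; 1/_; _⊔_; _≤_; _<_;
         Positive; NonZero; positive; nonNegative)
open import Data.Rational.Properties hiding (_≟_)
open import Data.Rational.Solver using (module +-*-Solver)
import Data.Rational.Unnormalised as ℚᵘ
import Data.Rational.Unnormalised.Properties as ℚᵘ
open import Data.Sum using (inj₁; inj₂)
open import Data.Vec using (lookup)
open import Data.Vec.Properties using ([]=⇒lookup; lookup⇒[]=)
open import Function.Bundles using (mk⇔)
open import Induction.WellFounded using (Acc; acc)
open import Relation.Binary.PropositionalEquality
open import Relation.Nullary.Decidable using (Dec; ⌊_⌋; yes; no; ¬?; _×-dec_)
open import Algebra.Properties.Semiring.Mult (CommutativeRing.semiring +-*-commutativeRing)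
  using (×-homo-+; ×-assoc-*; ×1-homo-*)
  renaming (_×_ to _·_)

open +-*-Solver

sumFin-cong : ∀ {n} {f g : Fin n → ℚ} → (∀ i → f i ≡ g i) → sumFin f ≡ sumFin g
sumFin-cong {zero}  f≗g = refl
sumFin-cong {suc n} f≗g = cong₂ _+_ (f≗g F.zero) (sumFin-cong λ i → f≗g (F.suc i))

sumFin-zero : ∀ n → sumFin {n} (λ _ → 0ℚ) ≡ 0ℚ
sumFin-zero zero    = refl
sumFin-zero (suc n) = cong (0ℚ +_) (sumFin-zero n)

sumFin-distrib-+ : ∀ {n} (f g : Fin n → ℚ) → sumFin (λ i → f i + g i) ≡ sumFin f + sumFin g
sumFin-distrib-+ {zero}  f g = refl
sumFin-distrib-+ {suc n} f g =
  trans (cong (f F.zero + g F.zero +_) (sumFin-distrib-+ (λ i → f (F.suc i)) (λ i → g (F.suc i))))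
        (+-interchange (f F.zero) (g F.zero) _ _)
  where
  +-interchange : ∀ a b c d → (a + b) + (c + d) ≡ (a + c) + (b + d)
  +-interchange = solve 4 (λ a b c d → (a :+ b) :+ (c :+ d) := (a :+ c) :+ (b :+ d)) refl

sumFin-distrib-neg : ∀ {n} (f : Fin n → ℚ) → sumFin (λ i → - f i) ≡ - sumFin f
sumFin-distrib-neg {zero}  f = refl
sumFin-distrib-neg {suc n} f =
  trans (cong (- f F.zero +_) (sumFin-distrib-neg λ i → f (F.suc i))) (sym (neg-distrib-+ (f F.zero) _))

sumFin-distrib-sub : ∀ {n} (f g : Fin n → ℚ) → sumFin (λ i → f i - g i) ≡ sumFin f - sumFin g
sumFin-distrib-sub f g = trans (sumFin-distrib-+ f (λ i → - g i)) (cong (sumFin f +_) (sumFin-distrib-neg g))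

sumFin-comm : ∀ {m n} (f : Fin m → Fin n → ℚ) →
  sumFin (λ i → sumFin (λ j → f i j)) ≡ sumFin (λ j → sumFin (λ i → f i j))
sumFin-comm {zero}  {n} f = sym (sumFin-zero n)
sumFin-comm {suc m} {n} f =
  trans (cong (sumFin (f F.zero) +_) (sumFin-comm λ i → f (F.suc i)))
        (sym (sumFin-distrib-+ (f F.zero) (λ j → sumFin λ i → f (F.suc i) j)))

sumFin-mono-≤ : ∀ {n} {f g : Fin n → ℚ} → (∀ i → f i ≤ g i) → sumFin f ≤ sumFin g
sumFin-mono-≤ {zero}  f≤g = ≤-refl
sumFin-mono-≤ {suc n} f≤g = +-mono-≤ (f≤g F.zero) (sumFin-mono-≤ λ i → f≤g (F.suc i))

sumFin-nonNeg : ∀ {n} {f : Fin n → ℚ} → (∀ i → 0ℚ ≤ f i) → 0ℚ ≤ sumFin f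
sumFin-nonNeg {n} {f} 0≤f = subst (_≤ sumFin f) (sumFin-zero n) (sumFin-mono-≤ 0≤f)

sumFin₂-distrib-+ : ∀ {m n} (f g : Fin m → Fin n → ℚ) →
  sumFin (λ i → sumFin λ j → f i j + g i j) ≡ sumFin (λ i → sumFin (f i)) + sumFin (λ i → sumFin (g i))
sumFin₂-distrib-+ f g =
  trans (sumFin-cong λ i → sumFin-distrib-+ (f i) (g i)) (sumFin-distrib-+ (λ i → sumFin (f i)) (λ i → sumFin (g i)))

if-sumFin : ∀ {n} (b : Bool) (f : Fin n → ℚ) →
  (if b then sumFin f else 0ℚ) ≡ sumFin (λ i → if b then f i else 0ℚ)
if-sumFin true  f = refl
if-sumFin {n} false f = sym (sumFin-zero n)

sumFin-indicator : ∀ {n} (v : Fin n) (a : ℚ) → sumFin (λ i → if ⌊ i ≟ v ⌋ then a else 0ℚ) ≡ a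
sumFin-indicator {suc n} F.zero    a = trans (cong (a +_) (sumFin-zero n)) (+-identityʳ a)
sumFin-indicator {suc n} (F.suc v) a =
  trans (+-identityˡ _) (trans (sumFin-cong suc≟suc) (sumFin-indicator v a))
  where
  suc≟suc : ∀ i → (if ⌊ F.suc i ≟ F.suc v ⌋ then a else 0ℚ) ≡ (if ⌊ i ≟ v ⌋ then a else 0ℚ)
  suc≟suc i with i ≟ v
  ... | yes _ = refl
  ... | no  _ = refl

∧≡true⇒ˡ : ∀ {a b} → a ∧ b ≡ true → a ≡ true
∧≡true⇒ˡ {true} _ = refl

if-nonNeg : ∀ b {p} → (b ≡ true → 0ℚ ≤ p) → 0ℚ ≤ (if b then p else 0ℚ)
if-nonNeg true  0≤p = 0≤p refl
if-nonNeg false 0≤p = ≤-refl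

if-mono-≤ : ∀ b {p q} → (b ≡ true → p ≤ q) → (if b then p else 0ℚ) ≤ (if b then q else 0ℚ)
if-mono-≤ true  p≤q = p≤q refl
if-mono-≤ false p≤q = ≤-refl

if-distrib-sub : ∀ b p q → (if b then p - q else 0ℚ) ≡ (if b then p else 0ℚ) - (if b then q else 0ℚ)
if-distrib-sub true  p q = refl
if-distrib-sub false p q = refl

if-distrib-+ : ∀ b p q → (if b then p + q else 0ℚ) ≡ (if b then p else 0ℚ) + (if b then q else 0ℚ)
if-distrib-+ true  p q = refl
if-distrib-+ false p q = refl

if-split : ∀ a p q (v : ℚ) → (if q then (if a then v else 0ℚ) else 0ℚ)
                            ≡ (if a ∧ not p ∧ q then v else 0ℚ) + (if a ∧ p ∧ q then v else 0ℚ)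
if-split false p     false v = refl
if-split false p     true  v = refl
if-split true  false false v = refl
if-split true  true  false v = refl
if-split true  false true  v = sym (+-identityʳ v)
if-split true  true  true  v = sym (+-identityˡ v)

∉⇒lookup≡false : ∀ {n} {S : Subset n} {v} → v ∉ S → lookup S v ≡ false
∉⇒lookup≡false {S = S} {v} v∉S = ¬-not λ Sv≡true → v∉S (lookup⇒[]= v S Sv≡true)

lookup≡false⇒∉ : ∀ {n} {S : Subset n} {v} → lookup S v ≡ false → v ∉ S
lookup≡false⇒∉ Sv≡false v∈S with () ← trans (sym Sv≡false) ([]=⇒lookup v∈S)

module _ (u : ℚ) where

  Multiple : ℚ → Set
  Multiple q = Σ ℕ λ m → q ≡ m · u

  IntMultiple : ℚ → Set
  IntMultiple q = Σ ℕ λ m → Σ ℕ λ m′ → q ≡ m · u - m′ · u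

  ·-nonNeg : 0ℚ ≤ u → ∀ m → 0ℚ ≤ m · u
  ·-nonNeg 0≤u zero    = ≤-refl
  ·-nonNeg 0≤u (suc m) = +-mono-≤ 0≤u (·-nonNeg 0≤u m)

  Multiple-0 : Multiple 0ℚ
  Multiple-0 = 0 , refl

  Multiple-+ : ∀ {p q} → Multiple p → Multiple q → Multiple (p + q)
  Multiple-+ (m , refl) (m′ , refl) = m ℕ.+ m′ , sym (×-homo-+ u m m′)

  Multiple-if : ∀ b {q} → (b ≡ true → Multiple q) → Multiple (if b then q else 0ℚ)
  Multiple-if true  mq = mq refl
  Multiple-if false mq = Multiple-0

  Multiple-sumFin : ∀ {n} {f : Fin n → ℚ} → (∀ i → Multiple (f i)) → Multiple (sumFin f)
  Multiple-sumFin {zero}  mf = Multiple-0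
  Multiple-sumFin {suc n} mf = Multiple-+ (mf F.zero) (Multiple-sumFin λ i → mf (F.suc i))

  Multiple⇒IntMultiple : ∀ {q} → Multiple q → IntMultiple q
  Multiple⇒IntMultiple (m , refl) = m , 0 , sym (+-identityʳ (m · u))

  IntMultiple-+ : ∀ {p q} → IntMultiple p → IntMultiple q → IntMultiple (p + q)
  IntMultiple-+ (a , b , refl) (c , d , refl) = a ℕ.+ c , b ℕ.+ d , (begin
    (a · u - b · u) + (c · u - d · u) ≡⟨ regroup (a · u) (b · u) (c · u) (d · u) ⟩
    (a · u + c · u) - (b · u + d · u) ≡⟨ sym (cong₂ _-_ (×-homo-+ u a c) (×-homo-+ u b d)) ⟩
    (a ℕ.+ c) · u - (b ℕ.+ d) · u     ∎)
    where
    open ≡-Reasoning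
    regroup : ∀ w x y z → (w - x) + (y - z) ≡ (w + y) - (x + z)
    regroup = solve 4 (λ w x y z → (w :- x) :+ (y :- z) := (w :+ y) :- (x :+ z)) refl

  IntMultiple-neg : ∀ {q} → IntMultiple q → IntMultiple (- q)
  IntMultiple-neg (a , b , refl) = b , a , solve 2 (λ x y → :- (x :- y) := y :- x) refl (a · u) (b · u)

  IntMultiple-sub : ∀ {p q} → IntMultiple p → IntMultiple q → IntMultiple (p - q)
  IntMultiple-sub mp mq = IntMultiple-+ mp (IntMultiple-neg mq)

  IntMultiple-⊔ : ∀ {p q} → IntMultiple p → IntMultiple q → IntMultiple (p ⊔ q)
  IntMultiple-⊔ {p} {q} mp mq with ⊔-sel p q
  ... | inj₁ p⊔q≡p = subst IntMultiple (sym p⊔q≡p) mp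
  ... | inj₂ p⊔q≡q = subst IntMultiple (sym p⊔q≡q) mq

  IntMultiple-<⇒≤0 : 0ℚ ≤ u → ∀ {q} → IntMultiple q → q < u → q ≤ 0ℚ
  IntMultiple-<⇒≤0 0≤u (m , m′ , refl) = go m m′
    where
    go : ∀ m m′ → m · u - m′ · u < u → m · u - m′ · u ≤ 0ℚ
    go zero    m′       _ = subst (_≤ 0ℚ) (sym (+-identityˡ _)) (neg-antimono-≤ (·-nonNeg 0≤u m′))
    go (suc m) zero     mu<u = ⊥-elim (<-irrefl refl (<-≤-trans mu<u (begin
      u                 ≡⟨ sym (+-identityʳ u) ⟩
      u + 0ℚ            ≤⟨ +-monoʳ-≤ u (·-nonNeg 0≤u m) ⟩
      u + m · u         ≡⟨ sym (+-identityʳ _) ⟩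
      suc m · u - 0ℚ    ∎)))
      where open ≤-Reasoning
    go (suc m) (suc m′) mu<u = subst (_≤ 0ℚ) (sym cancel) (go m m′ (subst (_< u) cancel mu<u))
      where
      cancel : (u + m · u) - (u + m′ · u) ≡ m · u - m′ · u
      cancel = solve 3 (λ u x y → (u :+ x) :- (u :+ y) := x :- y) refl u (m · u) (m′ · u)

-- A common unit for finitely many rationals

·1-toℚᵘ : ∀ a → toℚᵘ (a · 1ℚ) ℚᵘ.≃ ℚᵘ.mkℚᵘ (ℤ.+ a) 0
·1-toℚᵘ zero    = ℚᵘ.*≡* refl
·1-toℚᵘ (suc a) = ℚᵘ.≃-trans (toℚᵘ-homo-+ 1ℚ (a · 1ℚ))
  (ℚᵘ.≃-trans (ℚᵘ.+-congʳ (toℚᵘ 1ℚ) (·1-toℚᵘ a))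
    (ℚᵘ.*≡* (cong (λ x → x ℤ.* ℤ.1ℤ) (cong (ℤ._+_ ℤ.1ℤ) (ℤ.*-identityʳ (ℤ.+ a))))))

q*↧q≡↥q : ∀ q → 0ℚ ≤ q → q * (↧ₙ q · 1ℚ) ≡ ℤ.∣ ↥ q ∣ · 1ℚ
q*↧q≡↥q q@(mkℚ (ℤ.+ p) d _) _ = toℚᵘ-injective (begin
  toℚᵘ (q * (suc d · 1ℚ))                     ≈⟨ toℚᵘ-homo-* q (suc d · 1ℚ) ⟩
  toℚᵘ q ℚᵘ.* toℚᵘ (suc d · 1ℚ)               ≈⟨ ℚᵘ.*-congˡ {toℚᵘ q} (·1-toℚᵘ (suc d)) ⟩
  toℚᵘ q ℚᵘ.* ℚᵘ.mkℚᵘ (ℤ.+ suc d) 0           ≈⟨ ℚᵘ.*≡* (ℤ.*-assoc (ℤ.+ p) (ℤ.+ suc d) ℤ.1ℤ) ⟩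
  ℚᵘ.mkℚᵘ (ℤ.+ p) 0                           ≈⟨ ℚᵘ.≃-sym (·1-toℚᵘ p) ⟩
  toℚᵘ (p · 1ℚ)                               ∎)
  where open ℚᵘ.≃-Reasoning
q*↧q≡↥q (mkℚ ℤ.-[1+ _ ] _ _) 0≤q with () ← nonNegative 0≤q

denominator∣⇒Multiple : ∀ {u} D → D · 1ℚ * u ≡ 1ℚ → ∀ {q} → 0ℚ ≤ q → ↧ₙ q ∣ D → Multiple u q
denominator∣⇒Multiple {u} D D·u≡1 {q} 0≤q (divides k D≡k*den) = k ℕ.* p , (begin
  q                                     ≡⟨ sym (*-identityʳ q) ⟩
  q * 1ℚ                                ≡⟨ cong (q *_) (sym D·u≡1) ⟩
  q * (D · 1ℚ * u)                      ≡⟨ cong (λ e → q * (e · 1ℚ * u)) D≡k*den ⟩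
  q * ((k ℕ.* den) · 1ℚ * u)            ≡⟨ cong (λ e → q * (e * u)) (×1-homo-* k den) ⟩
  q * (k · 1ℚ * den · 1ℚ * u)           ≡⟨ regroup q (k · 1ℚ) (den · 1ℚ) u ⟩
  k · 1ℚ * (q * den · 1ℚ) * u           ≡⟨ cong (λ e → k · 1ℚ * e * u) (q*↧q≡↥q q 0≤q) ⟩
  k · 1ℚ * p · 1ℚ * u                   ≡⟨ cong (_* u) (sym (×1-homo-* k p)) ⟩
  (k ℕ.* p) · 1ℚ * u                    ≡⟨ ×-assoc-* (k ℕ.* p) 1ℚ u ⟩
  (k ℕ.* p) · (1ℚ * u)                  ≡⟨ cong ((k ℕ.* p) ·_) (*-identityˡ u) ⟩
  (k ℕ.* p) · u                         ∎)
  where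
  open ≡-Reasoning
  den = ↧ₙ q
  p = ℤ.∣ ↥ q ∣
  regroup : ∀ q a b u → q * (a * b * u) ≡ a * (q * b) * u
  regroup = solve 4 (λ q a b u → q :* (a :* b :* u) := a :* (q :* b) :* u) refl

·1-pos : ∀ k → .{{ℕ.NonZero k}} → 0ℚ < k · 1ℚ
·1-pos (suc k) = <-≤-trans (positive⁻¹ 1ℚ) (begin
  1ℚ            ≡⟨ sym (+-identityʳ 1ℚ) ⟩
  1ℚ + 0ℚ       ≤⟨ +-monoʳ-≤ 1ℚ (·-nonNeg 1ℚ (nonNegative⁻¹ 1ℚ) k) ⟩
  1ℚ + k · 1ℚ   ∎)
  where open ≤-Reasoning

productFin : ∀ {m} → (Fin m → ℕ) → ℕ
productFin {zero}  g = 1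
productFin {suc m} g = g F.zero ℕ.* productFin (λ i → g (F.suc i))

∣-productFin : ∀ {m} (g : Fin m → ℕ) i → g i ∣ productFin g
∣-productFin g F.zero    = m∣m*n _
∣-productFin g (F.suc i) = ∣n⇒∣m*n (g F.zero) (∣-productFin (λ i → g (F.suc i)) i)

productFin-nonZero : ∀ {m} (g : Fin m → ℕ) → (∀ i → ℕ.NonZero (g i)) → ℕ.NonZero (productFin g)
productFin-nonZero {zero}  g g≢0 = _
productFin-nonZero {suc m} g g≢0 =
  m*n≢0 _ _ {{g≢0 F.zero}} {{productFin-nonZero (λ i → g (F.suc i)) λ i → g≢0 (F.suc i)}}

record CommonUnit {m n} (c : Fin m → Fin n → ℚ) : Set where
  field
    unit     : ℚ
    unit>0   : 0ℚ < unit
    count    : ℕ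
    1≡count  : 1ℚ ≡ count · unit
    multiple : ∀ i j → 0ℚ ≤ c i j → Multiple unit (c i j)

commonUnit : ∀ {m n} (c : Fin m → Fin n → ℚ) → CommonUnit c
commonUnit c = record
  { unit     = u
  ; unit>0   = positive⁻¹ u {{1/pos⇒pos (D · 1ℚ)}}
  ; count    = D
  ; 1≡count  = trans (sym D·u≡1) (trans (×-assoc-* D 1ℚ u) (cong (D ·_) (*-identityˡ u)))
  ; multiple = λ i j 0≤c → denominator∣⇒Multiple D D·u≡1 0≤c (∣-trans (∣-productFin _ j) (∣-productFin _ i))
  }
  where
  D = productFin λ i → productFin λ j → ↧ₙ c i j
  instance
    D≢0 : ℕ.NonZero D
    D≢0 = productFin-nonZero _ λ i → productFin-nonZero (λ j → ↧ₙ c i j) λ j → _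
    D·1-pos : Positive (D · 1ℚ)
    D·1-pos = positive (·1-pos D)
    D·1≢0 : NonZero (D · 1ℚ)
    D·1≢0 = pos⇒nonZero (D · 1ℚ)
  u = 1/ (D · 1ℚ)
  D·u≡1 : D · 1ℚ * u ≡ 1ℚ
  D·u≡1 = *-inverseʳ (D · 1ℚ)

p⊔0-[-p]⊔0≡p : ∀ q → (q ⊔ 0ℚ) - ((- q) ⊔ 0ℚ) ≡ q
p⊔0-[-p]⊔0≡p q with ≤-total 0ℚ q
... | inj₁ 0≤q = begin
  (q ⊔ 0ℚ) - ((- q) ⊔ 0ℚ)  ≡⟨ cong₂ _-_ (p≥q⇒p⊔q≡p 0≤q) (p≤q⇒p⊔q≡q (neg-antimono-≤ 0≤q)) ⟩
  q - 0ℚ                   ≡⟨ +-identityʳ q ⟩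
  q                        ∎
  where open ≡-Reasoning
... | inj₂ q≤0 = begin
  (q ⊔ 0ℚ) - ((- q) ⊔ 0ℚ)  ≡⟨ cong₂ _-_ (p≤q⇒p⊔q≡q q≤0) (p≥q⇒p⊔q≡p (neg-antimono-≤ q≤0)) ⟩
  0ℚ - (- q)               ≡⟨ solve 1 (λ q → con 0ℚ :- (:- q) := q) refl q ⟩
  q                        ∎
  where open ≡-Reasoning

decidableChoice : ∀ {n} {A : Set} {P : Fin n → Set} {Q : Fin n → A → Set} → A → (∀ v → Dec (P v)) →
  (∀ v → P v → Σ A (Q v)) → Σ (Fin n → A) λ f → ∀ v → P v → Q v (f v)
decidableChoice {P = P} {Q} default P? witness = (λ v → proj₁ (choose v)) , λ v → proj₂ (choose v)
  where
  choose : ∀ v → Σ _ λ a → P v → Q v a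
  choose v with P? v
  ... | yes pv = proj₁ (witness v pv) , λ _ → proj₂ (witness v pv)
  ... | no ¬pv = default , λ pv → ⊥-elim (¬pv pv)

-- Flows and cuts

module Flows (I : Instance) where
  open Instance I renaming (sym to adj-sym)

  netInflow : ArcVec I → Fin n → ℚ
  netInflow x i = inflow I x i - outflow I x i

  sumOver : Subset n → (Fin n → ℚ) → ℚ
  sumOver S g = sumFin λ i → if lookup S i then g i else 0ℚ

  cutOut : Subset n → ArcVec I → ℚ
  cutOut S x = sumFin λ i → sumFin λ j → if adj i j ∧ not (lookup S j) ∧ lookup S i then x i j else 0ℚ

  inside : Subset n → ArcVec I → ℚ
  inside S x = sumFin λ i → sumFin λ j → if adj i j ∧ lookup S i ∧ lookup S j then x i j else 0ℚ

  module _ (S : Subset n) (x : ArcVec I) where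

    sumOver-inflow : sumOver S (inflow I x) ≡ cutIn I S x + inside S x
    sumOver-inflow = begin
      sumOver S (inflow I x)
        ≡⟨ sumFin-cong (λ i → if-sumFin (lookup S i) λ h → if adj h i then x h i else 0ℚ) ⟩
      sumFin (λ i → sumFin λ h → if lookup S i then (if adj h i then x h i else 0ℚ) else 0ℚ)
        ≡⟨ sumFin-comm (λ i h → if lookup S i then (if adj h i then x h i else 0ℚ) else 0ℚ) ⟩
      sumFin (λ h → sumFin λ i → if lookup S i then (if adj h i then x h i else 0ℚ) else 0ℚ)
        ≡⟨ sumFin-cong (λ h → sumFin-cong λ i → if-split (adj h i) (lookup S h) (lookup S i) (x h i)) ⟩
      sumFin (λ h → sumFin λ i → (if adj h i ∧ not (lookup S h) ∧ lookup S i then x h i else 0ℚ)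
                               + (if adj h i ∧ lookup S h ∧ lookup S i then x h i else 0ℚ))
        ≡⟨ sumFin₂-distrib-+ (λ h i → if adj h i ∧ not (lookup S h) ∧ lookup S i then x h i else 0ℚ) _ ⟩
      cutIn I S x + inside S x ∎
      where open ≡-Reasoning

    sumOver-outflow : sumOver S (outflow I x) ≡ cutOut S x + inside S x
    sumOver-outflow = begin
      sumOver S (outflow I x)
        ≡⟨ sumFin-cong (λ i → if-sumFin (lookup S i) λ j → if adj i j then x i j else 0ℚ) ⟩
      sumFin (λ i → sumFin λ j → if lookup S i then (if adj i j then x i j else 0ℚ) else 0ℚ)
        ≡⟨ sumFin-cong (λ i → sumFin-cong λ j → if-split (adj i j) (lookup S j) (lookup S i) (x i j)) ⟩
      sumFin (λ i → sumFin λ j → (if adj i j ∧ not (lookup S j) ∧ lookup S i then x i j else 0ℚ)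
                               + (if adj i j ∧ lookup S j ∧ lookup S i then x i j else 0ℚ))
        ≡⟨ sumFin₂-distrib-+ (λ i j → if adj i j ∧ not (lookup S j) ∧ lookup S i then x i j else 0ℚ) _ ⟩
      cutOut S x + sumFin (λ i → sumFin λ j → if adj i j ∧ lookup S j ∧ lookup S i then x i j else 0ℚ)
        ≡⟨ cong (cutOut S x +_) (sumFin-cong λ i → sumFin-cong λ j →
             cong (λ b → if adj i j ∧ b then x i j else 0ℚ) (∧-comm (lookup S j) (lookup S i))) ⟩
      cutOut S x + inside S x ∎
      where open ≡-Reasoning

    divergence : sumOver S (netInflow x) ≡ cutIn I S x - cutOut S x
    divergence = begin
      sumOver S (netInflow x)
        ≡⟨ sumFin-cong (λ i → if-distrib-sub (lookup S i) _ _) ⟩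
      sumFin (λ i → (if lookup S i then inflow I x i else 0ℚ) - (if lookup S i then outflow I x i else 0ℚ))
        ≡⟨ sumFin-distrib-sub (λ i → if lookup S i then inflow I x i else 0ℚ) _ ⟩
      sumOver S (inflow I x) - sumOver S (outflow I x)
        ≡⟨ cong₂ _-_ sumOver-inflow sumOver-outflow ⟩
      (cutIn I S x + inside S x) - (cutOut S x + inside S x)
        ≡⟨ solve 3 (λ a b e → (a :+ e) :- (b :+ e) := a :- b) refl (cutIn I S x) (cutOut S x) (inside S x) ⟩
      cutIn I S x - cutOut S x ∎
      where open ≡-Reasoning

  sumOver-demand : ∀ {S t} a → r ∉ S → t ∈ S → sumOver S (demand I t a) ≡ a
  sumOver-demand {S} {t} a r∉S t∈S = trans (sumFin-cong demand-on-S) (sumFin-indicator t a)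
    where
    demand-on-S : ∀ i → (if lookup S i then demand I t a i else 0ℚ) ≡ (if ⌊ i ≟ t ⌋ then a else 0ℚ)
    demand-on-S i with i ≟ r | i ≟ t
    ... | yes refl | yes refl = ⊥-elim (r∉S t∈S)
    ... | yes refl | no  _    rewrite ∉⇒lookup≡false r∉S = refl
    ... | no  _    | yes refl rewrite []=⇒lookup t∈S = refl
    ... | no  _    | no  _    with lookup S i
    ...   | true  = refl
    ...   | false = refl

  flowValue : ∀ {S t a} (f : ArcVec I) → r ∉ S → t ∈ S →
    (∀ i → netInflow f i ≡ demand I t a i) → a ≡ cutIn I S f - cutOut S f
  flowValue {S} {t} {a} f r∉S t∈S conserves = begin
    a                         ≡⟨ sym (sumOver-demand a r∉S t∈S) ⟩
    sumOver S (demand I t a)  ≡⟨ sumFin-cong (λ i → cong (λ d → if lookup S i then d else 0ℚ) (sym (conserves i))) ⟩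
    sumOver S (netInflow f)   ≡⟨ divergence S f ⟩
    cutIn I S f - cutOut S f  ∎
    where open ≡-Reasoning

  cutArc : ∀ S i j → adj i j ∧ not (lookup S i) ∧ lookup S j ≡ true → Arc I i j × i ∉ S × j ∈ S
  cutArc S i j _ with adj i j | lookup S i in Si | lookup S j in Sj
  ... | true | false | true = refl , lookup≡false⇒∉ Si , lookup⇒[]= j S Sj

  cutIn-mono-≤ : ∀ S {x y : ArcVec I} → (∀ i j → Arc I i j → i ∉ S → j ∈ S → x i j ≤ y i j) →
    cutIn I S x ≤ cutIn I S y
  cutIn-mono-≤ S x≤y = sumFin-mono-≤ λ i → sumFin-mono-≤ λ j → if-mono-≤ _ λ ij∈δ⁻S →
    let (ij , i∉S , j∈S) = cutArc S i j ij∈δ⁻S in x≤y i j ij i∉S j∈S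

  cutIn-nonNeg : ∀ S {x : ArcVec I} → (∀ i j → Arc I i j → 0ℚ ≤ x i j) → 0ℚ ≤ cutIn I S x
  cutIn-nonNeg S 0≤x = sumFin-nonNeg λ i → sumFin-nonNeg λ j → if-nonNeg _ λ e → 0≤x i j (∧≡true⇒ˡ e)

  cutOut-nonNeg : ∀ S {x : ArcVec I} → (∀ i j → Arc I i j → 0ℚ ≤ x i j) → 0ℚ ≤ cutOut S x
  cutOut-nonNeg S 0≤x = sumFin-nonNeg λ i → sumFin-nonNeg λ j → if-nonNeg _ λ e → 0≤x i j (∧≡true⇒ˡ e)

  cutIn-Multiple : ∀ {u} S {x : ArcVec I} → (∀ i j → Arc I i j → Multiple u (x i j)) → Multiple u (cutIn I S x)
  cutIn-Multiple {u} S mx =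
    Multiple-sumFin u λ i → Multiple-sumFin u λ j → Multiple-if u _ λ e → mx i j (∧≡true⇒ˡ e)

  cutIn-transpose : ∀ S (x : ArcVec I) → cutIn I S (λ i j → x j i) ≡ cutOut S x
  cutIn-transpose S x = trans (sumFin-comm (λ i j → if adj i j ∧ not (lookup S i) ∧ lookup S j then x j i else 0ℚ))
    (sumFin-cong λ j → sumFin-cong λ i →
      cong (λ b → if b ∧ not (lookup S i) ∧ lookup S j then x j i else 0ℚ) (adj-sym i j))

  record FeasibleFlow (c : ArcVec I) (t : Fin n) (a : ℚ) (f : ArcVec I) : Set where
    field
      nonNeg    : ∀ i j → Arc I i j → 0ℚ ≤ f i j
      ≤capacity : ∀ i j → Arc I i j → f i j ≤ c i j
      conserves : ∀ i → netInflow f i ≡ demand I t a i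

  weakDuality : ∀ {c t a f} → FeasibleFlow c t a f → ∀ {S} → r ∉ S → t ∈ S → a ≤ cutIn I S c
  weakDuality {c} {t} {a} {f} feasible {S} r∉S t∈S = begin
    a                         ≡⟨ flowValue f r∉S t∈S conserves ⟩
    cutIn I S f - cutOut S f  ≤⟨ +-monoʳ-≤ (cutIn I S f) (neg-antimono-≤ (cutOut-nonNeg S nonNeg)) ⟩
    cutIn I S f - 0ℚ          ≡⟨ +-identityʳ (cutIn I S f) ⟩
    cutIn I S f               ≤⟨ cutIn-mono-≤ S (λ i j ij _ _ → ≤capacity i j ij) ⟩
    cutIn I S c               ∎
    where
    open FeasibleFlow feasible
    open ≤-Reasoning

  _⊕_ : ArcVec I → ArcVec I → ArcVec I
  (x ⊕ y) i j = x i j + y i j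

  netInflow-⊕ : ∀ x y i → netInflow (x ⊕ y) i ≡ netInflow x i + netInflow y i
  netInflow-⊕ x y i = begin
    inflow I (x ⊕ y) i - outflow I (x ⊕ y) i
      ≡⟨ cong₂ _-_ (trans (sumFin-cong λ h → if-distrib-+ (adj h i) (x h i) (y h i)) (sumFin-distrib-+ {n} _ _))
                   (trans (sumFin-cong λ j → if-distrib-+ (adj i j) (x i j) (y i j)) (sumFin-distrib-+ {n} _ _)) ⟩
    (inflow I x i + inflow I y i) - (outflow I x i + outflow I y i)
      ≡⟨ solve 4 (λ a b c d → (a :+ b) :- (c :+ d) := (a :- c) :+ (b :- d)) refl
           (inflow I x i) (inflow I y i) (outflow I x i) (outflow I y i) ⟩
    netInflow x i + netInflow y i ∎
    where open ≡-Reasoning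

  netInflow-zero : ∀ i → netInflow (λ _ _ → 0ℚ) i ≡ 0ℚ
  netInflow-zero i = cong₂ _-_ (zero-sum (λ h → adj h i)) (zero-sum (adj i))
    where
    zero-sum : (b : Fin n → Bool) → sumFin (λ h → if b h then 0ℚ else 0ℚ) ≡ 0ℚ
    zero-sum b = trans (sumFin-cong λ h → if-eta (b h)) (sumFin-zero n)

  netInflow-skew : ∀ x i → netInflow x i ≡ sumFin λ h → if adj h i then x h i - x i h else 0ℚ
  netInflow-skew x i = begin
    inflow I x i - outflow I x i
      ≡⟨ cong (_-_ (inflow I x i)) (sumFin-cong λ j → cong (λ b → if b then x i j else 0ℚ) (adj-sym i j)) ⟩
    inflow I x i - sumFin (λ h → if adj h i then x i h else 0ℚ)
      ≡⟨ sym (sumFin-distrib-sub (λ h → if adj h i then x h i else 0ℚ) _) ⟩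
    sumFin (λ h → (if adj h i then x h i else 0ℚ) - (if adj h i then x i h else 0ℚ))
      ≡⟨ sumFin-cong (λ h → sym (if-distrib-sub (adj h i) (x h i) (x i h))) ⟩
    sumFin (λ h → if adj h i then x h i - x i h else 0ℚ) ∎
    where open ≡-Reasoning

  cutIn-distrib-sub : ∀ S (x y : ArcVec I) → cutIn I S (λ i j → x i j - y i j) ≡ cutIn I S x - cutIn I S y
  cutIn-distrib-sub S x y = trans
    (sumFin-cong λ i → trans (sumFin-cong λ j → if-distrib-sub (adj i j ∧ not (lookup S i) ∧ lookup S j) (x i j) (y i j))
                             (sumFin-distrib-sub (λ j → if adj i j ∧ not (lookup S i) ∧ lookup S j then x i j else 0ℚ) _))
    (sumFin-distrib-sub (λ i → sumFin λ j → if adj i j ∧ not (lookup S i) ∧ lookup S j then x i j else 0ℚ) _)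

  demand-+ : ∀ t p q i → demand I t p i + demand I t q i ≡ demand I t (q + p) i
  demand-+ t p q i with ⌊ i ≟ r ⌋ | ⌊ i ≟ t ⌋
  ... | true  | _     = solve 2 (λ p q → :- p :+ :- q := :- (q :+ p)) refl p q
  ... | false | true  = +-comm p q
  ... | false | false = refl

  -- Augmenting by multiples of a unit

  module MaxFlow (u : ℚ) (u>0 : 0ℚ < u) (c : ArcVec I)
                 (c≥0 : ∀ i j → Arc I i j → 0ℚ ≤ c i j)
                 (c-discrete : ∀ i j → Arc I i j → IntMultiple u (c i j))
                 (t : Fin n) (t≢r : t ≢ r) where

    0≤u : 0ℚ ≤ u
    0≤u = <⇒≤ u>0

    arc-sym : ∀ {i j} → Arc I i j → Arc I j i
    arc-sym {i} {j} ij = trans (adj-sym j i) ij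

    unitAt : Fin n → Fin n → ℚ
    unitAt v i = if ⌊ i ≟ v ⌋ then u else 0ℚ

    unitArc : Fin n → Fin n → ArcVec I
    unitArc a b i j = if ⌊ i ≟ a ⌋ ∧ ⌊ j ≟ b ⌋ then u else 0ℚ

    inflow-unitArc : ∀ {a b} → Arc I a b → ∀ i → inflow I (unitArc a b) i ≡ unitAt b i
    inflow-unitArc {a} {b} ab i = trans (sumFin-cong from-a) (sumFin-indicator a (unitAt b i))
      where
      from-a : ∀ h → (if adj h i then unitArc a b h i else 0ℚ) ≡ (if ⌊ h ≟ a ⌋ then unitAt b i else 0ℚ)
      from-a h with h ≟ a | i ≟ b
      ... | yes refl | yes refl rewrite ab = refl
      ... | yes refl | no  _    = if-eta (adj h i)
      ... | no  _    | _        = if-eta (adj h i)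

    outflow-unitArc : ∀ {a b} → Arc I a b → ∀ i → outflow I (unitArc a b) i ≡ unitAt a i
    outflow-unitArc {a} {b} ab i = trans (sumFin-cong into-b) (sumFin-indicator b (unitAt a i))
      where
      into-b : ∀ j → (if adj i j then unitArc a b i j else 0ℚ) ≡ (if ⌊ j ≟ b ⌋ then unitAt a i else 0ℚ)
      into-b j with i ≟ a | j ≟ b
      ... | yes refl | yes refl rewrite ab = refl
      ... | yes refl | no  _    = if-eta (adj i j)
      ... | no  _    | yes refl = if-eta (adj i j)
      ... | no  _    | no  _    = if-eta (adj i j)

    netInflow-unitArc : ∀ {a b} → Arc I a b → ∀ i → netInflow (unitArc a b) i ≡ unitAt b i - unitAt a i
    netInflow-unitArc ab i = cong₂ _-_ (inflow-unitArc ab i) (outflow-unitArc ab i)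

    unitAt-sub : ∀ {v} → v ≢ r → ∀ i → unitAt v i - unitAt r i ≡ demand I v u i
    unitAt-sub {v} v≢r i with i ≟ r | i ≟ v
    ... | yes refl | yes refl = ⊥-elim (v≢r refl)
    ... | yes _    | no  _    = +-identityˡ (- u)
    ... | no  _    | yes _    = +-identityʳ u
    ... | no  _    | no  _    = refl

    residual : ArcVec I → ArcVec I
    residual f i j = (c i j - f i j) + f j i

    record DiscreteFlow (val : ℚ) : Set where
      field
        flow     : ArcVec I
        feasible : FeasibleFlow c t val flow
        discrete : ∀ i j → Arc I i j → IntMultiple u (flow i j)
      open FeasibleFlow feasible public

    residual-nonNeg : ∀ {val} (F : DiscreteFlow val) → ∀ i j → Arc I i j → 0ℚ ≤ residual (DiscreteFlow.flow F) i j
    residual-nonNeg F i j ij = begin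
      0ℚ                           ≡⟨ sym (+-inverseʳ (flow i j)) ⟩
      flow i j - flow i j          ≤⟨ +-monoˡ-≤ (- flow i j) (≤capacity i j ij) ⟩
      c i j - flow i j             ≡⟨ sym (+-identityʳ _) ⟩
      (c i j - flow i j) + 0ℚ      ≤⟨ +-monoʳ-≤ (c i j - flow i j) (nonNeg j i (arc-sym ij)) ⟩
      residual flow i j            ∎
      where
      open DiscreteFlow F
      open ≤-Reasoning

    -- A flow of u units from r to b in the residual network of f that uses only arcs ending in R
    -- (conservation is stated so that b = r is the zero flow).  Extending it by an arc into a new
    -- vertex then cannot stack on flow already on that arc.
    record Augmenting (f : ArcVec I) (R : Subset n) (b : Fin n) : Set where
      field
        path      : ArcVec I
        nonNeg    : ∀ i j → Arc I i j → 0ℚ ≤ path i j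
        ≤residual : ∀ i j → Arc I i j → path i j ≤ residual f i j
        multiple  : ∀ i j → Arc I i j → Multiple u (path i j)
        enters-R  : ∀ i j → j ∉ R → path i j ≡ 0ℚ
        conserves : ∀ i → netInflow path i ≡ unitAt b i - unitAt r i

    augmenting-root : ∀ {f R} → (∀ i j → Arc I i j → 0ℚ ≤ residual f i j) → Augmenting f R r
    augmenting-root 0≤res = record
      { path      = λ _ _ → 0ℚ
      ; nonNeg    = λ _ _ _ → ≤-refl
      ; ≤residual = 0≤res
      ; multiple  = λ _ _ _ → Multiple-0 u
      ; enters-R  = λ _ _ _ → refl
      ; conserves = λ i → trans (netInflow-zero i) (sym (+-inverseʳ (unitAt r i)))
      }

    augmenting-⊆ : ∀ {f R R′ b} → R ⊆ R′ → Augmenting f R b → Augmenting f R′ b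
    augmenting-⊆ R⊆R′ P = record
      { path      = path
      ; nonNeg    = nonNeg
      ; ≤residual = ≤residual
      ; multiple  = multiple
      ; enters-R  = λ i j j∉R′ → enters-R i j λ j∈R → j∉R′ (R⊆R′ j∈R)
      ; conserves = conserves
      }
      where open Augmenting P

    augmenting-extend : ∀ {f R a b} → Augmenting f R a → Arc I a b → b ∉ R → u ≤ residual f a b →
      Augmenting f (R ∪ ⁅ b ⁆) b
    augmenting-extend {f} {R} {a} {b} P ab b∉R u≤res = record
      { path      = path ⊕ unitArc a b
      ; nonNeg    = λ i j ij → +-mono-≤ (nonNeg i j ij) (if-nonNeg _ λ _ → 0≤u)
      ; ≤residual = ≤residual′
      ; multiple  = λ i j ij → Multiple-+ u (multiple i j ij) (Multiple-if u _ λ _ → 1 , sym (+-identityʳ u))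
      ; enters-R  = enters-R′
      ; conserves = conserves′
      }
      where
      open Augmenting P

      ≤residual′ : ∀ i j → Arc I i j → path i j + unitArc a b i j ≤ residual f i j
      ≤residual′ i j ij with i ≟ a | j ≟ b
      ... | yes refl | yes refl =
        subst (_≤ residual f i j) (trans (sym (+-identityˡ u)) (cong (_+ u) (sym (enters-R i j b∉R)))) u≤res
      ... | yes _    | no  _    = subst (_≤ residual f i j) (sym (+-identityʳ (path i j))) (≤residual i j ij)
      ... | no  _    | _        = subst (_≤ residual f i j) (sym (+-identityʳ (path i j))) (≤residual i j ij)

      enters-R′ : ∀ i j → j ∉ R ∪ ⁅ b ⁆ → path i j + unitArc a b i j ≡ 0ℚ
      enters-R′ i j j∉R∪b with j ≟ b
      ... | yes refl = ⊥-elim (j∉R∪b (x∈p∪q⁺ (inj₂ (x∈⁅x⁆ j))))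
      ... | no  _    = cong₂ _+_ (enters-R i j λ j∈R → j∉R∪b (p⊆p∪q ⁅ b ⁆ j∈R))
                                 (cong (λ β → if β then u else 0ℚ) (∧-zeroʳ ⌊ i ≟ a ⌋))

      conserves′ : ∀ i → netInflow (path ⊕ unitArc a b) i ≡ unitAt b i - unitAt r i
      conserves′ i = begin
        netInflow (path ⊕ unitArc a b) i
          ≡⟨ netInflow-⊕ path (unitArc a b) i ⟩
        netInflow path i + netInflow (unitArc a b) i
          ≡⟨ cong₂ _+_ (conserves i) (netInflow-unitArc ab i) ⟩
        (unitAt a i - unitAt r i) + (unitAt b i - unitAt a i)
          ≡⟨ solve 3 (λ x y z → (x :- y) :+ (z :- x) := z :- y) refl (unitAt a i) (unitAt r i) (unitAt b i) ⟩
        unitAt b i - unitAt r i ∎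
        where open ≡-Reasoning

    Reached : ArcVec I → Subset n → Set
    Reached f R = ∀ b → b ∈ R → Augmenting f R b

    Closed : ArcVec I → Subset n → Set
    Closed f R = ∀ a b → a ∈ R → Arc I a b → b ∉ R → residual f a b < u

    record Search (f : ArcVec I) : Set where
      field
        R       : Subset n
        r∈R     : r ∈ R
        reached : Reached f R
        closed  : Closed f R

    module _ (f : ArcVec I) (0≤res : ∀ i j → Arc I i j → 0ℚ ≤ residual f i j) where

      Exit : Subset n → Fin n → Fin n → Set
      Exit R a b = a ∈ R × Arc I a b × b ∉ R × u ≤ residual f a b

      exit? : ∀ R a b → Dec (Exit R a b)
      exit? R a b = a ∈? R ×-dec adj a b Bool.≟ true ×-dec ¬? (b ∈? R) ×-dec u ≤? residual f a b

      reached-∪ : ∀ {R a b} → Reached f R → Exit R a b → Reached f (R ∪ ⁅ b ⁆)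
      reached-∪ {R} {a} {b} reached (a∈R , ab , b∉R , u≤res) b′ b′∈R∪b with x∈p∪q⁻ R ⁅ b ⁆ b′∈R∪b
      ... | inj₁ b′∈R  = augmenting-⊆ (p⊆p∪q ⁅ b ⁆) (reached b′ b′∈R)
      ... | inj₂ b′∈⁅b⁆ = subst (Augmenting f (R ∪ ⁅ b ⁆)) (sym (x∈⁅y⁆⇒x≡y b b′∈⁅b⁆))
                                (augmenting-extend (reached a a∈R) ab b∉R u≤res)

      explore : ∀ R → Acc _⊃_ R → r ∈ R → Reached f R → Search f
      explore R (acc larger) r∈R reached with any? (λ a → any? (exit? R a))
      ... | yes (a , b , exit@(_ , _ , b∉R , _)) =
        explore (R ∪ ⁅ b ⁆) (larger (p⊆p∪q ⁅ b ⁆ , b , x∈p∪q⁺ (inj₂ (x∈⁅x⁆ b)) , b∉R))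
                (p⊆p∪q ⁅ b ⁆ r∈R) (reached-∪ reached exit)
      ... | no no-exit = record
        { R = R ; r∈R = r∈R ; reached = reached
        ; closed = λ a b a∈R ab b∉R → ≰⇒> λ u≤res → no-exit (a , b , a∈R , ab , b∉R , u≤res) }

      search : Search f
      search = explore ⁅ r ⁆ (⊃-wellFounded _) (x∈⁅x⁆ r) λ b b∈⁅r⁆ →
        subst (Augmenting f ⁅ r ⁆) (sym (x∈⁅y⁆⇒x≡y r b∈⁅r⁆)) (augmenting-root 0≤res)

    residual-discrete : ∀ {val} (F : DiscreteFlow val) → ∀ i j → Arc I i j →
      IntMultiple u (residual (DiscreteFlow.flow F) i j)
    residual-discrete F i j ij =
      IntMultiple-+ u (IntMultiple-sub u (c-discrete i j ij) (discrete i j ij)) (discrete j i (arc-sym ij))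
      where open DiscreteFlow F

    closed-cut≤value : ∀ {val} (F : DiscreteFlow val) {R} → Closed (DiscreteFlow.flow F) R →
      r ∈ R → t ∉ R → cutIn I (∁ R) c ≤ val
    closed-cut≤value {val} F {R} closed r∈R t∉R = begin
      cutIn I (∁ R) c                                   ≤⟨ cutIn-mono-≤ (∁ R) saturated ⟩
      cutIn I (∁ R) (λ i j → flow i j - flow j i)       ≡⟨ cutIn-distrib-sub (∁ R) flow (λ i j → flow j i) ⟩
      cutIn I (∁ R) flow - cutIn I (∁ R) (λ i j → flow j i)
                                                        ≡⟨ cong (_-_ (cutIn I (∁ R) flow)) (cutIn-transpose (∁ R) flow) ⟩
      cutIn I (∁ R) flow - cutOut (∁ R) flow            ≡⟨ sym (flowValue flow (x∈p⇒x∉∁p r∈R) (x∉p⇒x∈∁p t∉R) conserves) ⟩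
      val                                               ∎
      where
      open DiscreteFlow F
      open ≤-Reasoning
      -- an arc leaving R has residual capacity below u, hence none at all
      saturated : ∀ i j → Arc I i j → i ∉ ∁ R → j ∈ ∁ R → c i j ≤ flow i j - flow j i
      saturated i j ij i∉∁R j∈∁R = begin
        c i j
          ≡⟨ solve 3 (λ c x y → c := ((c :- x) :+ y) :+ (x :- y)) refl (c i j) (flow i j) (flow j i) ⟩
        residual flow i j + (flow i j - flow j i)  ≤⟨ +-monoˡ-≤ (flow i j - flow j i) res≤0 ⟩
        0ℚ + (flow i j - flow j i)                 ≡⟨ +-identityˡ _ ⟩
        flow i j - flow j i                        ∎
        where
        res≤0 : residual flow i j ≤ 0ℚ
        res≤0 = IntMultiple-<⇒≤0 u 0≤u (residual-discrete F i j ij)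
                  (closed i j (x∉∁p⇒x∈p i∉∁R) ij (x∈∁p⇒x∉p j∈∁R))

    augmentAlong : ∀ {val R} (F : DiscreteFlow val) → Augmenting (DiscreteFlow.flow F) R t → DiscreteFlow (u + val)
    augmentAlong {val} F P = record
      { flow     = f′
      ; feasible = record
        { nonNeg    = λ i j _ → p≤q⊔p (δ i j) 0ℚ
        ; ≤capacity = λ i j ij → ⊔-lub (δ≤c i j ij) (c≥0 i j ij)
        ; conserves = λ i → trans (netInflow-augmented i)
            (trans (cong₂ _+_ (Flow.conserves i) (trans (Path.conserves i) (unitAt-sub t≢r i))) (demand-+ t val u i))
        }
      ; discrete = λ i j ij → IntMultiple-⊔ u (δ-discrete i j ij) (Multiple⇒IntMultiple u (Multiple-0 u))
      }
      where
      module Flow = DiscreteFlow F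
      module Path = Augmenting P
      f = Flow.flow
      p = Path.path

      δ : ArcVec I
      δ i j = (f i j - f j i) + (p i j - p j i)

      -- Taking the positive part of the combined net flow cancels opposite flows, which keeps f′ ≤ c.
      f′ : ArcVec I
      f′ i j = δ i j ⊔ 0ℚ

      δ≤c : ∀ i j → Arc I i j → δ i j ≤ c i j
      δ≤c i j ij = begin
        (f i j - f j i) + (p i j - p j i)
          ≤⟨ +-monoʳ-≤ (f i j - f j i) (+-monoʳ-≤ (p i j) (neg-antimono-≤ (Path.nonNeg j i (arc-sym ij)))) ⟩
        (f i j - f j i) + (p i j - 0ℚ)      ≡⟨ cong (_+_ (f i j - f j i)) (+-identityʳ (p i j)) ⟩
        (f i j - f j i) + p i j             ≤⟨ +-monoʳ-≤ (f i j - f j i) (Path.≤residual i j ij) ⟩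
        (f i j - f j i) + residual f i j
          ≡⟨ solve 3 (λ x y c → (x :- y) :+ ((c :- x) :+ y) := c) refl (f i j) (f j i) (c i j) ⟩
        c i j                               ∎
        where open ≤-Reasoning

      δ-discrete : ∀ i j → Arc I i j → IntMultiple u (δ i j)
      δ-discrete i j ij = IntMultiple-+ u
        (IntMultiple-sub u (Flow.discrete i j ij) (Flow.discrete j i (arc-sym ij)))
        (IntMultiple-sub u (Multiple⇒IntMultiple u (Path.multiple i j ij))
                           (Multiple⇒IntMultiple u (Path.multiple j i (arc-sym ij))))

      δ-antisym : ∀ i j → δ j i ≡ - δ i j
      δ-antisym i j = solve 4 (λ a b x y → (b :- a) :+ (y :- x) := :- ((a :- b) :+ (x :- y))) refl
                              (f i j) (f j i) (p i j) (p j i)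

      netInflow-augmented : ∀ i → netInflow f′ i ≡ netInflow f i + netInflow p i
      netInflow-augmented i = begin
        netInflow f′ i
          ≡⟨ netInflow-skew f′ i ⟩
        sumFin (λ h → if adj h i then (δ h i ⊔ 0ℚ) - (δ i h ⊔ 0ℚ) else 0ℚ)
          ≡⟨ sumFin-cong (λ h → cong (λ d → if adj h i then d else 0ℚ)
               (trans (cong (λ e → (δ h i ⊔ 0ℚ) - (e ⊔ 0ℚ)) (δ-antisym h i)) (p⊔0-[-p]⊔0≡p (δ h i)))) ⟩
        sumFin (λ h → if adj h i then (f h i - f i h) + (p h i - p i h) else 0ℚ)
          ≡⟨ sumFin-cong (λ h → if-distrib-+ (adj h i) _ _) ⟩
        sumFin (λ h → (if adj h i then f h i - f i h else 0ℚ) + (if adj h i then p h i - p i h else 0ℚ))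
          ≡⟨ sumFin-distrib-+ {n} _ _ ⟩
        sumFin (λ h → if adj h i then f h i - f i h else 0ℚ) + sumFin (λ h → if adj h i then p h i - p i h else 0ℚ)
          ≡⟨ sym (cong₂ _+_ (netInflow-skew f i) (netInflow-skew p i)) ⟩
        netInflow f i + netInflow p i ∎
        where open ≡-Reasoning

    augment : ∀ {val} → DiscreteFlow val → (∀ S → r ∉ S → t ∈ S → u + val ≤ cutIn I S c) → DiscreteFlow (u + val)
    augment {val} F cuts with search (DiscreteFlow.flow F) (residual-nonNeg F)
    ... | record { R = R ; r∈R = r∈R ; reached = reached ; closed = closed } with t ∈? R
    ...   | yes t∈R = augmentAlong F (reached t t∈R)
    ...   | no  t∉R = ⊥-elim (<-irrefl refl (<-≤-trans val<u+val (begin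
      u + val          ≤⟨ cuts (∁ R) (x∈p⇒x∉∁p r∈R) (x∉p⇒x∈∁p t∉R) ⟩
      cutIn I (∁ R) c  ≤⟨ closed-cut≤value F closed r∈R t∉R ⟩
      val              ∎)))
      where
      open ≤-Reasoning
      val<u+val : val < u + val
      val<u+val = subst (_< u + val) (+-identityˡ val) (+-monoˡ-< val u>0)

    zeroFlow : DiscreteFlow 0ℚ
    zeroFlow = record
      { flow     = λ _ _ → 0ℚ
      ; feasible = record
        { nonNeg    = λ _ _ _ → ≤-refl
        ; ≤capacity = c≥0
        ; conserves = λ i → trans (netInflow-zero i) (no-demand i)
        }
      ; discrete = λ _ _ _ → Multiple⇒IntMultiple u (Multiple-0 u)
      }
      where
      no-demand : ∀ i → 0ℚ ≡ demand I t 0ℚ i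
      no-demand i with ⌊ i ≟ r ⌋ | ⌊ i ≟ t ⌋
      ... | true  | _     = refl
      ... | false | true  = refl
      ... | false | false = refl

    discreteFlow : ∀ m → (∀ S → r ∉ S → t ∈ S → m · u ≤ cutIn I S c) → DiscreteFlow (m · u)
    discreteFlow zero    _    = zeroFlow
    discreteFlow (suc m) cuts = augment (discreteFlow m λ S r∉S t∈S → ≤-trans m·u≤u+m·u (cuts S r∉S t∈S)) cuts
      where
      m·u≤u+m·u : m · u ≤ u + m · u
      m·u≤u+m·u = subst (_≤ u + m · u) (+-identityˡ (m · u)) (+-monoˡ-≤ (m · u) 0≤u)

  integralMaxFlow : ∀ {c t a} u → 0ℚ < u → (∀ i j → Arc I i j → 0ℚ ≤ c i j) →
    (∀ i j → Arc I i j → Multiple u (c i j)) → t ≢ r → Multiple u a →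
    (∀ S → r ∉ S → t ∈ S → a ≤ cutIn I S c) → Σ (ArcVec I) (FeasibleFlow c t a)
  integralMaxFlow {c} {t} u u>0 c≥0 c-multiple t≢r (m , refl) cuts = flow , feasible
    where
    open MaxFlow u u>0 c c≥0 (λ i j ij → Multiple⇒IntMultiple u (c-multiple i j ij)) t t≢r
    open DiscreteFlow (discreteFlow m cuts)

module Theorem7 (I : Instance) (z : ArcVec I) (y : Fin (Instance.K I) → ArcVec I) where
  open Instance I renaming (sym to adj-sym)
  open Flows I

  ≢r-in-cut : ∀ {S v} → r ∉ S → v ∈ S → v ≢ r
  ≢r-in-cut r∉S v∈S refl = r∉S v∈S

  flow-In01 : ∀ {c t a f} → FeasibleFlow c t a f → (∀ i j → Arc I i j → In01 I (c i j)) →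
    ∀ i j → Arc I i j → In01 I (f i j)
  flow-In01 feasible c∈01 i j ij = nonNeg i j ij , ≤-trans (≤capacity i j ij) (proj₂ (c∈01 i j ij))
    where open FeasibleFlow feasible

  cuts⇒flows : Pdc2 I z y → ∃[ w ] ∃[ f0 ] ∃[ fk ] Pdf I z y w f0 fk
  cuts⇒flows (z∈01 , y∈01 , z-cuts , y-cuts , z≤y , z-in≤1) =
      w , f0 , fk
    , z∈01 , y∈01
    , (λ v v≢r → cutIn-nonNeg ⁅ v ⁆ (λ i j ij → proj₁ (z∈01 i j ij)) , z-in≤1 v v≢r)
    , (λ v v≢r → flow-In01 (f0-feasible v v≢r) z∈01)
    , (λ k t t∈T t≢r → flow-In01 (fk-feasible k t t∈T t≢r) (y∈01 k))
    , (λ v v≢r → FeasibleFlow.≤capacity (f0-feasible v v≢r))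
    , (λ v _ → ≤-refl)
    , (λ v v≢r → FeasibleFlow.conserves (f0-feasible v v≢r))
    , z≤y
    , (λ k i j ij t t∈T t≢r → FeasibleFlow.≤capacity (fk-feasible k t t∈T t≢r) i j ij)
    , (λ k t t∈T t≢r → FeasibleFlow.conserves (fk-feasible k t t∈T t≢r))
    where
    w : Fin n → ℚ
    w v = cutIn I ⁅ v ⁆ z

    firstStage : ∀ v → v ≢ r → Σ (ArcVec I) (FeasibleFlow z v (w v))
    firstStage v v≢r =
      integralMaxFlow unit unit>0 z≥0 z-multiple v≢r (cutIn-Multiple ⁅ v ⁆ z-multiple) λ S r∉S v∈S → z-cuts S r∉S v v∈S
      where
      open CommonUnit (commonUnit z)
      z≥0 : ∀ i j → Arc I i j → 0ℚ ≤ z i j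
      z≥0 i j ij = proj₁ (z∈01 i j ij)
      z-multiple : ∀ i j → Arc I i j → Multiple unit (z i j)
      z-multiple i j ij = multiple i j (z≥0 i j ij)

    secondStage : ∀ k t → t ∈ T k × t ≢ r → Σ (ArcVec I) (FeasibleFlow (y k) t 1ℚ)
    secondStage k t (t∈T , t≢r) =
      integralMaxFlow unit unit>0 y≥0 y-multiple t≢r (count , 1≡count) λ S r∉S t∈S → y-cuts k S r∉S (t , t∈S , t∈T)
      where
      open CommonUnit (commonUnit (y k))
      y≥0 : ∀ i j → Arc I i j → 0ℚ ≤ y k i j
      y≥0 i j ij = proj₁ (y∈01 k i j ij)
      y-multiple : ∀ i j → Arc I i j → Multiple unit (y k i j)
      y-multiple i j ij = multiple i j (y≥0 i j ij)

    zeroVec : ArcVec I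
    zeroVec _ _ = 0ℚ

    f0 : Fin n → ArcVec I
    f0 = proj₁ (decidableChoice zeroVec (λ v → ¬? (v ≟ r)) firstStage)

    f0-feasible : ∀ v → v ≢ r → FeasibleFlow z v (w v) (f0 v)
    f0-feasible = proj₂ (decidableChoice zeroVec (λ v → ¬? (v ≟ r)) firstStage)

    fk : Fin K → Fin n → ArcVec I
    fk k = proj₁ (decidableChoice zeroVec (λ t → t ∈? T k ×-dec ¬? (t ≟ r)) (secondStage k))

    fk-feasible : ∀ k t → t ∈ T k → t ≢ r → FeasibleFlow (y k) t 1ℚ (fk k t)
    fk-feasible k t t∈T t≢r =
      proj₂ (decidableChoice zeroVec (λ t → t ∈? T k ×-dec ¬? (t ≟ r)) (secondStage k)) t (t∈T , t≢r)

  flows⇒cuts : ∃[ w ] ∃[ f0 ] ∃[ fk ] Pdf I z y w f0 fk → Pdc2 I z y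
  flows⇒cuts (w , f0 , fk , z∈01 , y∈01 , w∈01 , f0∈01 , fk∈01 , f0≤z , z-in≤w , f0-conserves ,
              z≤y , fk≤y , fk-conserves) =
    z∈01 , y∈01 , z-cuts , y-cuts , z≤y , λ v v≢r → ≤-trans (z-in≤w v v≢r) (proj₂ (w∈01 v v≢r))
    where
    z-cuts : ∀ S → r ∉ S → ∀ v → v ∈ S → cutIn I ⁅ v ⁆ z ≤ cutIn I S z
    z-cuts S r∉S v v∈S = ≤-trans (z-in≤w v v≢r) (weakDuality f0-feasible r∉S v∈S)
      where
      v≢r = ≢r-in-cut r∉S v∈S
      f0-feasible : FeasibleFlow z v (w v) (f0 v)
      f0-feasible = record
        { nonNeg    = λ i j ij → proj₁ (f0∈01 v v≢r i j ij)
        ; ≤capacity = f0≤z v v≢r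
        ; conserves = f0-conserves v v≢r
        }

    y-cuts : ∀ k S → r ∉ S → ∃[ t ] (t ∈ S × t ∈ T k) → 1ℚ ≤ cutIn I S (y k)
    y-cuts k S r∉S (t , t∈S , t∈T) = weakDuality fk-feasible r∉S t∈S
      where
      t≢r = ≢r-in-cut r∉S t∈S
      fk-feasible : FeasibleFlow (y k) t 1ℚ (fk k t)
      fk-feasible = record
        { nonNeg    = λ i j ij → proj₁ (fk∈01 k t t∈T t≢r i j ij)
        ; ≤capacity = λ i j ij → fk≤y k i j ij t t∈T t≢r
        ; conserves = fk-conserves k t t∈T t≢r
        }

open Instance

mainTheorem7 : (I : Instance) (z : ArcVec I) (y : Fin (K I) → ArcVec I) →
    Pdc2 I z y ⇔ (∃[ w ] ∃[ f0 ] ∃[ fk ] Pdf I z y w f0 fk)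
mainTheorem7 I z y = mk⇔ cuts⇒flows flows⇒cuts
  where open Theorem7 I z y
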